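{- (1) $g_1(n)\geq 21h_1(n)$ for all $n\geq 20$. (2) $g_2(n)\geq 21h_2(n)$ for all $n\geq 51$. (3) $g_3(n)\geq 21h_3(n)$ for all $n\geq 67$. (4) For every $k\geq 4$, $g_k(n)\geq 21h_k(n)$ for all $n\geq 0$.
   Context: For $k\geq 0$, $g_k(n)$ is the number of pairs $(\alpha,\beta)$ of partitions, each with at most $k$ parts, with $|\alpha|+|\beta|=n$; so $\sum_{n\geq0}g_k(n)q^n=1/(q;q)_k^2$ (with $g_0(0)=1$, $g_0(n)=0$ for $n\geq1$, and $g_k(n)=0$ for $n<0$). For $k\geq 2$, $h_k(n)$ is the number of pairs $(\alpha,\beta)$ of partitions, each with exactly $k$ parts, with $|\alpha|+|\beta|=n$ and such that the largest part of $\beta$ appears at least twice; $h_1(n)=1$ for $n\geq2$ and $h_1(0)=h_1(1)=0$; $h_k(n)=0$ for $n<0$. Thus for $k\geq 1$, $\sum_{n\geq0}h_k(n)q^n=\frac{q^{2k}}{(q;q)_k(q^2;q)_{k-1}}$, where $(a;q)_j=\prod_{i=0}^{j-1}(1-aq^i)$. -}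

module Defs where

open import Data.Nat using (ℕ; zero; suc; _∸_; _≤ᵇ_; _≡ᵇ_)
open import Data.Bool using (Bool; true; false; _∧_)
open import Data.List using (List; []; _∷_; [_]; map; concatMap; filterᵇ; length; upTo; cartesianProduct)
open import Data.Product using (_×_; _,_)

-- plist f m n : all partitions of n (as non-increasing lists of positive
-- integers) whose parts are all ≤ m; f is fuel (f ≥ n suffices).
plist : ℕ → ℕ → ℕ → List (List ℕ)
plist _       m zero    = [ [] ]
plist zero    m (suc n) = []
plist (suc f) m (suc n) =
  concatMap (λ p → map (p ∷_) (plist f p (suc n ∸ p)))
            (filterᵇ (λ p → p ≤ᵇ suc n) (map suc (upTo m)))

Partitions : ℕ → List (List ℕ)
Partitions n = plist n n n

PartitionPairs : ℕ → List (List ℕ × List ℕ)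
PartitionPairs n =
  concatMap (λ a → cartesianProduct (Partitions a) (Partitions (n ∸ a))) (upTo (suc n))

count : ℕ → List ℕ → ℕ
count x xs = length (filterᵇ (λ y → y ≡ᵇ x) xs)

-- the largest part of β appears at least twice (β non-increasing, so its
-- head is its largest part); false for the empty partition
largestRepeated : List ℕ → Bool
largestRepeated []      = false
largestRepeated (x ∷ xs) = 2 ≤ᵇ count x (x ∷ xs)

g : ℕ → ℕ → ℕ
g k n = length (filterᵇ (λ { (α , β) → (length α ≤ᵇ k) ∧ (length β ≤ᵇ k) })
                        (PartitionPairs n))

-- h k n : for k ≥ 2, pairs of partitions each with exactly k parts, total
-- size n, largest part of β appearing at least twice; h 1 n = 1 for n ≥ 2,
-- h 1 0 = h 1 1 = 0.  (h 0 is not defined in the paper; set to 0, unused.)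
h : ℕ → ℕ → ℕ
h zero          n = 0
h (suc zero)    n = if 2 ≤ᵇ n then 1 else 0
  where open import Data.Bool using (if_then_else_)
h (suc (suc j)) n =
  length (filterᵇ (λ { (α , β) → (length α ≡ᵇ suc (suc j)) ∧ (length β ≡ᵇ suc (suc j))
                                   ∧ largestRepeated β })
                  (PartitionPairs n))

-- With P k = 1/(q;q)_k, the series of g k is G k = P k², and since a partition with exactly k
-- parts either repeats its largest part or comes from a partition of n − 1 by raising its largest
-- part, the series of h k is q^(2k) (1 − q) P k² = q^(2k) D k. As G k = D k/(1 − q) is the
-- sequence of partial sums of D k, the claim reads 21 D k m ≤ Σ_{i ≤ m + 2k} D k i. The
-- coefficients of D k increase and satisfy m D k m ≤ (2k − 1) Σ_{i < m} D k i, each division by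
-- 1 − q^a raising this growth constant by one; this settles all large m, and the remaining m for
-- k = 2, 3, 4 are checked by computing coefficients. Dividing both sides by (1 − q^(k+1))²
-- preserves an inequality 21 Y n ≤ X (n + s), which carries k = 4 to every k ≥ 4.

module Submission where

open import Data.Bool using (Bool; true; false; _∧_; if_then_else_; T)
open import Data.Bool.Properties using (∧-identityʳ; T-≡; T-∧)
open import Data.List using (List; []; _∷_; [_]; _++_; map; concatMap; filterᵇ; length; upTo; cartesianProduct)
open import Data.List.Properties using (upTo-∷ʳ; map-++; map-∘)
open import Data.Nat
open import Data.Nat.Induction using (<-rec)
open import Data.Nat.ListAction using (sum)
open import Data.Nat.ListAction.Properties using (sum-++)
open import Data.Nat.Properties
open import Algebra.Properties.CommutativeSemigroup +-commutativeSemigroup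
  using () renaming (interchange to +-interchange)
open import Data.Nat.Tactic.RingSolver using (solve-∀)
open import Data.Product using (_×_; _,_; proj₁; proj₂)
open import Data.Sum using (inj₁; inj₂)
open import Function using (_∘_; case_of_)
open import Function.Bundles using (Equivalence)
open import Relation.Binary.PropositionalEquality
  using (_≡_; refl; sym; trans; cong; cong₂; subst; subst₂; module ≡-Reasoning)
open import Relation.Nullary using (yes; no; contradiction)

open import Defs

private variable A B : Set

fromBool : Bool → ℕ
fromBool true  = 1
fromBool false = 0

countWhere : (A → Bool) → List A → ℕ
countWhere p xs = length (filterᵇ p xs)

countWhere-∷ : (p : A → Bool) (x : A) (xs : List A) →
               countWhere p (x ∷ xs) ≡ fromBool (p x) + countWhere p xs
countWhere-∷ p x xs with p x
... | true  = refl
... | false = refl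

countWhere-++ : (p : A → Bool) (xs ys : List A) →
                countWhere p (xs ++ ys) ≡ countWhere p xs + countWhere p ys
countWhere-++ p []       ys = refl
countWhere-++ p (x ∷ xs) ys with p x
... | true  = cong suc (countWhere-++ p xs ys)
... | false = countWhere-++ p xs ys

countWhere-map : (p : B → Bool) (f : A → B) (xs : List A) →
                 countWhere p (map f xs) ≡ countWhere (p ∘ f) xs
countWhere-map p f []       = refl
countWhere-map p f (x ∷ xs) with p (f x)
... | true  = cong suc (countWhere-map p f xs)
... | false = countWhere-map p f xs

countWhere-cong : {p q : A → Bool} → (∀ x → p x ≡ q x) → (xs : List A) →
                  countWhere p xs ≡ countWhere q xs
countWhere-cong {p = p} {q} p≗q []       = refl
countWhere-cong {p = p} {q} p≗q (x ∷ xs) = begin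
  countWhere p (x ∷ xs)            ≡⟨ countWhere-∷ p x xs ⟩
  fromBool (p x) + countWhere p xs ≡⟨ cong₂ _+_ (cong fromBool (p≗q x)) (countWhere-cong p≗q xs) ⟩
  fromBool (q x) + countWhere q xs ≡⟨ countWhere-∷ q x xs ⟨
  countWhere q (x ∷ xs)            ∎
  where open ≡-Reasoning

countWhere-false : (xs : List A) → countWhere (λ _ → false) xs ≡ 0
countWhere-false []       = refl
countWhere-false (x ∷ xs) = countWhere-false xs

countWhere-∧-≤ : (p q : A → Bool) (xs : List A) → countWhere (λ x → p x ∧ q x) xs ≤ countWhere q xs
countWhere-∧-≤ p q []       = z≤n
countWhere-∧-≤ p q (x ∷ xs) with p x | q x
... | true  | true  = s≤s (countWhere-∧-≤ p q xs)
... | true  | false = countWhere-∧-≤ p q xs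
... | false | true  = m≤n⇒m≤1+n (countWhere-∧-≤ p q xs)
... | false | false = countWhere-∧-≤ p q xs

countWhere-cartesianProduct :
  (p : A → Bool) (q : B → Bool) (xs : List A) (ys : List B) →
  countWhere (λ xy → p (proj₁ xy) ∧ q (proj₂ xy)) (cartesianProduct xs ys) ≡ countWhere p xs * countWhere q ys
countWhere-cartesianProduct p q []       ys = refl
countWhere-cartesianProduct p q (x ∷ xs) ys = begin
  countWhere r (map (x ,_) ys ++ cartesianProduct xs ys)
    ≡⟨ countWhere-++ r (map (x ,_) ys) (cartesianProduct xs ys) ⟩
  countWhere r (map (x ,_) ys) + countWhere r (cartesianProduct xs ys)
    ≡⟨ cong₂ _+_ (trans (countWhere-map r (x ,_) ys) (row (p x))) (countWhere-cartesianProduct p q xs ys) ⟩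
  fromBool (p x) * countWhere q ys + countWhere p xs * countWhere q ys
    ≡⟨ *-distribʳ-+ (countWhere q ys) (fromBool (p x)) (countWhere p xs) ⟨
  (fromBool (p x) + countWhere p xs) * countWhere q ys
    ≡⟨ cong (_* countWhere q ys) (countWhere-∷ p x xs) ⟨
  countWhere p (x ∷ xs) * countWhere q ys ∎
  where
  open ≡-Reasoning
  r = λ xy → p (proj₁ xy) ∧ q (proj₂ xy)
  row : (b : Bool) → countWhere (λ y → b ∧ q y) ys ≡ fromBool b * countWhere q ys
  row true  = sym (+-identityʳ _)
  row false = countWhere-false ys

countWhere-concatMap : (p : B → Bool) (F : A → List B) (xs : List A) →
                       countWhere p (concatMap F xs) ≡ sum (map (λ x → countWhere p (F x)) xs)
countWhere-concatMap p F []       = refl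
countWhere-concatMap p F (x ∷ xs) =
  trans (countWhere-++ p (F x) (concatMap F xs)) (cong (countWhere p (F x) +_) (countWhere-concatMap p F xs))

Σ< : ℕ → (ℕ → ℕ) → ℕ
Σ< zero    F = 0
Σ< (suc n) F = Σ< n F + F n

syntax Σ< n (λ i → e) = ∑[ i < n ] e

Σ<-cong : (n : ℕ) {F G : ℕ → ℕ} → (∀ i → i < n → F i ≡ G i) → Σ< n F ≡ Σ< n G
Σ<-cong zero    F≗G = refl
Σ<-cong (suc n) F≗G = cong₂ _+_ (Σ<-cong n (λ i i<n → F≗G i (m<n⇒m<1+n i<n))) (F≗G n ≤-refl)

Σ<-zero : (n : ℕ) → ∑[ _ < n ] 0 ≡ 0
Σ<-zero zero    = refl
Σ<-zero (suc n) = trans (+-identityʳ _) (Σ<-zero n)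

Σ<-one : (n : ℕ) → ∑[ _ < n ] 1 ≡ n
Σ<-one zero    = refl
Σ<-one (suc n) = trans (cong (_+ 1) (Σ<-one n)) (+-comm n 1)

Σ<-+ : (n : ℕ) (F G : ℕ → ℕ) → ∑[ i < n ] (F i + G i) ≡ Σ< n F + Σ< n G
Σ<-+ zero    F G = refl
Σ<-+ (suc n) F G = trans (cong (_+ (F n + G n)) (Σ<-+ n F G)) (+-interchange (Σ< n F) (Σ< n G) (F n) (G n))

Σ<-suc : (n : ℕ) (F : ℕ → ℕ) → Σ< (suc n) F ≡ F 0 + Σ< n (F ∘ suc)
Σ<-suc zero    F = sym (+-identityʳ (F 0))
Σ<-suc (suc n) F = trans (cong (_+ F (suc n)) (Σ<-suc n F)) (+-assoc (F 0) _ _)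

sum-map-upTo : (F : ℕ → ℕ) (n : ℕ) → sum (map F (upTo n)) ≡ Σ< n F
sum-map-upTo F zero    = refl
sum-map-upTo F (suc n) = begin
  sum (map F (upTo (suc n)))       ≡⟨ cong (sum ∘ map F) (upTo-∷ʳ n) ⟨
  sum (map F (upTo n ++ [ n ]))    ≡⟨ cong sum (map-++ F (upTo n) [ n ]) ⟩
  sum (map F (upTo n) ++ [ F n ])  ≡⟨ sum-++ (map F (upTo n)) [ F n ] ⟩
  sum (map F (upTo n)) + (F n + 0) ≡⟨ cong₂ _+_ (sum-map-upTo F n) (+-identityʳ (F n)) ⟩
  Σ< n F + F n                     ∎
  where open ≡-Reasoning

sum-map-filterᵇ : (p : A → Bool) (F : A → ℕ) (xs : List A) →
                  sum (map F (filterᵇ p xs)) ≡ sum (map (λ x → if p x then F x else 0) xs)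
sum-map-filterᵇ p F []       = refl
sum-map-filterᵇ p F (x ∷ xs) with p x
... | true  = cong (F x +_) (sum-map-filterᵇ p F xs)
... | false = sum-map-filterᵇ p F xs

-- Power series

-- A power series over ℕ is its coefficient function ℕ → ℕ: shift a Y is q^a·Y,
-- conv is the product, and IsDiv a F Y says Y = F/(1 − q^a), i.e. Y = F + q^a·Y.

shift : ℕ → (ℕ → ℕ) → ℕ → ℕ
shift zero    Y n       = Y n
shift (suc a) Y zero    = 0
shift (suc a) Y (suc n) = shift a Y n

shift-≤ᵇ : (a : ℕ) (Y : ℕ → ℕ) (n : ℕ) → shift a Y n ≡ (if a ≤ᵇ n then Y (n ∸ a) else 0)
shift-≤ᵇ zero          Y n       = refl
shift-≤ᵇ (suc a)       Y zero    = refl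
shift-≤ᵇ (suc zero)    Y (suc n) = refl
shift-≤ᵇ (suc (suc a)) Y (suc n) = shift-≤ᵇ (suc a) Y n

shift-< : (a : ℕ) (Y : ℕ → ℕ) (n : ℕ) → n < a → shift a Y n ≡ 0
shift-< (suc a) Y zero    _         = refl
shift-< (suc a) Y (suc n) (s≤s n<a) = shift-< a Y n n<a

shift-+ˡ : (a : ℕ) (Y : ℕ → ℕ) (n : ℕ) → shift a Y (a + n) ≡ Y n
shift-+ˡ zero    Y n = refl
shift-+ˡ (suc a) Y n = shift-+ˡ a Y n

shift-cong : (a : ℕ) {Y Z : ℕ → ℕ} → (∀ i → Y i ≡ Z i) → (n : ℕ) → shift a Y n ≡ shift a Z n
shift-cong zero    Y≗Z n       = Y≗Z n
shift-cong (suc a) Y≗Z zero    = refl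
shift-cong (suc a) Y≗Z (suc n) = shift-cong a Y≗Z n

shift-cong-< : (a : ℕ) {Y Z : ℕ → ℕ} (n : ℕ) → (∀ i → i < n → Y i ≡ Z i) → shift (suc a) Y n ≡ shift (suc a) Z n
shift-cong-< a zero    Y≗Z = refl
shift-cong-< a (suc n) Y≗Z = go a n (λ i i≤n → Y≗Z i (s≤s i≤n))
  where
  go : (a n : ℕ) → (∀ i → i ≤ n → _ ≡ _) → shift a _ n ≡ shift a _ n
  go zero    n       Y≗Z = Y≗Z n ≤-refl
  go (suc a) zero    Y≗Z = refl
  go (suc a) (suc n) Y≗Z = go a n (λ i i≤n → Y≗Z i (m≤n⇒m≤1+n i≤n))

shift-+ : (a : ℕ) (Y Z : ℕ → ℕ) (n : ℕ) → shift a (λ i → Y i + Z i) n ≡ shift a Y n + shift a Z n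
shift-+ zero    Y Z n       = refl
shift-+ (suc a) Y Z zero    = refl
shift-+ (suc a) Y Z (suc n) = shift-+ a Y Z n

*-shift : (c a : ℕ) (Y : ℕ → ℕ) (n : ℕ) → c * shift a Y n ≡ shift a (λ i → c * Y i) n
*-shift c zero    Y n       = refl
*-shift c (suc a) Y zero    = *-zeroʳ c
*-shift c (suc a) Y (suc n) = *-shift c a Y n

shift-shift : (a b : ℕ) (Y : ℕ → ℕ) (n : ℕ) → shift a (shift b Y) n ≡ shift (a + b) Y n
shift-shift zero    b Y n       = refl
shift-shift (suc a) b Y zero    = refl
shift-shift (suc a) b Y (suc n) = shift-shift a b Y n

shift-comm : (a b : ℕ) (Y : ℕ → ℕ) (n : ℕ) → shift a (shift b Y) n ≡ shift b (shift a Y) n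
shift-comm a b Y n = begin
  shift a (shift b Y) n ≡⟨ shift-shift a b Y n ⟩
  shift (a + b) Y n     ≡⟨ cong (λ c → shift c Y n) (+-comm a b) ⟩
  shift (b + a) Y n     ≡⟨ shift-shift b a Y n ⟨
  shift b (shift a Y) n ∎
  where open ≡-Reasoning

conv : (ℕ → ℕ) → (ℕ → ℕ) → ℕ → ℕ
conv X Y n = ∑[ i < suc n ] (X i * Y (n ∸ i))

conv-congˡ : {X X′ : ℕ → ℕ} → (∀ i → X i ≡ X′ i) → (Y : ℕ → ℕ) (n : ℕ) → conv X Y n ≡ conv X′ Y n
conv-congˡ X≗X′ Y n = Σ<-cong (suc n) (λ i _ → cong (_* Y (n ∸ i)) (X≗X′ i))

conv-congʳ : (X : ℕ → ℕ) {Y Y′ : ℕ → ℕ} → (∀ i → Y i ≡ Y′ i) → (n : ℕ) → conv X Y n ≡ conv X Y′ n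
conv-congʳ X Y≗Y′ n = Σ<-cong (suc n) (λ i _ → cong (X i *_) (Y≗Y′ (n ∸ i)))

conv-+ˡ : (X Y Z : ℕ → ℕ) (n : ℕ) → conv (λ m → X m + Y m) Z n ≡ conv X Z n + conv Y Z n
conv-+ˡ X Y Z n = trans (Σ<-cong (suc n) (λ i _ → *-distribʳ-+ (Z (n ∸ i)) (X i) (Y i))) (Σ<-+ (suc n) _ _)

conv-+ʳ : (X Y Z : ℕ → ℕ) (n : ℕ) → conv X (λ m → Y m + Z m) n ≡ conv X Y n + conv X Z n
conv-+ʳ X Y Z n = trans (Σ<-cong (suc n) (λ i _ → *-distribˡ-+ (X i) (Y (n ∸ i)) (Z (n ∸ i)))) (Σ<-+ (suc n) _ _)

conv-shift1ˡ : (X Z : ℕ → ℕ) (n : ℕ) → conv (shift 1 X) Z n ≡ shift 1 (conv X Z) n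
conv-shift1ˡ X Z zero    = refl
conv-shift1ˡ X Z (suc n) = Σ<-suc (suc n) _

conv-shift1ʳ : (X Z : ℕ → ℕ) (n : ℕ) → conv X (shift 1 Z) n ≡ shift 1 (conv X Z) n
conv-shift1ʳ X Z zero    = *-zeroʳ (X 0)
conv-shift1ʳ X Z (suc n) = trans (cong₂ _+_ lower top) (+-identityʳ _)
  where
  lower : ∑[ i < suc n ] (X i * shift 1 Z (suc n ∸ i)) ≡ conv X Z n
  lower = Σ<-cong (suc n) (λ i i<1+n → cong (λ v → X i * shift 1 Z v) (+-∸-assoc 1 (≤-pred i<1+n)))
  top : X (suc n) * shift 1 Z (n ∸ n) ≡ 0
  top = trans (cong (λ v → X (suc n) * shift 1 Z v) (n∸n≡0 n)) (*-zeroʳ (X (suc n)))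

conv-shiftˡ : (a : ℕ) (X Z : ℕ → ℕ) (n : ℕ) → conv (shift a X) Z n ≡ shift a (conv X Z) n
conv-shiftˡ zero    X Z n = refl
conv-shiftˡ (suc a) X Z n = begin
  conv (shift (suc a) X) Z n       ≡⟨ conv-congˡ (shift-shift 1 a X) Z n ⟨
  conv (shift 1 (shift a X)) Z n   ≡⟨ conv-shift1ˡ (shift a X) Z n ⟩
  shift 1 (conv (shift a X) Z) n   ≡⟨ shift-cong 1 (conv-shiftˡ a X Z) n ⟩
  shift 1 (shift a (conv X Z)) n   ≡⟨ shift-shift 1 a (conv X Z) n ⟩
  shift (suc a) (conv X Z) n       ∎
  where open ≡-Reasoning

conv-shiftʳ : (a : ℕ) (X Z : ℕ → ℕ) (n : ℕ) → conv X (shift a Z) n ≡ shift a (conv X Z) n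
conv-shiftʳ zero    X Z n = refl
conv-shiftʳ (suc a) X Z n = begin
  conv X (shift (suc a) Z) n       ≡⟨ conv-congʳ X (shift-shift 1 a Z) n ⟨
  conv X (shift 1 (shift a Z)) n   ≡⟨ conv-shift1ʳ X (shift a Z) n ⟩
  shift 1 (conv X (shift a Z)) n   ≡⟨ shift-cong 1 (conv-shiftʳ a X Z) n ⟩
  shift 1 (shift a (conv X Z)) n   ≡⟨ shift-shift 1 a (conv X Z) n ⟩
  shift (suc a) (conv X Z) n       ∎
  where open ≡-Reasoning

IsDiv : ℕ → (ℕ → ℕ) → (ℕ → ℕ) → Set
IsDiv a F Y = ∀ n → Y n ≡ F n + shift a Y n

conv-isDivˡ : (a : ℕ) {X X′ : ℕ → ℕ} (Y : ℕ → ℕ) → IsDiv a X X′ → IsDiv a (conv X Y) (conv X′ Y)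
conv-isDivˡ a {X} {X′} Y X′=X/ n = begin
  conv X′ Y n                          ≡⟨ conv-congˡ X′=X/ Y n ⟩
  conv (λ m → X m + shift a X′ m) Y n  ≡⟨ conv-+ˡ X (shift a X′) Y n ⟩
  conv X Y n + conv (shift a X′) Y n   ≡⟨ cong (conv X Y n +_) (conv-shiftˡ a X′ Y n) ⟩
  conv X Y n + shift a (conv X′ Y) n   ∎
  where open ≡-Reasoning

conv-isDivʳ : (a : ℕ) (X : ℕ → ℕ) {Y Y′ : ℕ → ℕ} → IsDiv a Y Y′ → IsDiv a (conv X Y) (conv X Y′)
conv-isDivʳ a X {Y} {Y′} Y′=Y/ n = begin
  conv X Y′ n                          ≡⟨ conv-congʳ X Y′=Y/ n ⟩
  conv X (λ m → Y m + shift a Y′ m) n  ≡⟨ conv-+ʳ X Y (shift a Y′) n ⟩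
  conv X Y n + conv X (shift a Y′) n   ≡⟨ cong (conv X Y n +_) (conv-shiftʳ a X Y′ n) ⟩
  conv X Y n + shift a (conv X Y′) n   ∎
  where open ≡-Reasoning

isDiv-unique : (b : ℕ) {F Y Z : ℕ → ℕ} → IsDiv (suc b) F Y → IsDiv (suc b) F Z → ∀ n → Y n ≡ Z n
isDiv-unique b {F} {Y} {Z} Y=F/ Z=F/ = <-rec _ λ n ih →
  trans (Y=F/ n) (trans (cong (F n +_) (shift-cong-< b n (λ i i<n → ih i<n))) (sym (Z=F/ n)))

isDiv-swap : (a b : ℕ) {X Y X′ Y′ : ℕ → ℕ} →
             IsDiv a X Y → IsDiv (suc b) X X′ → IsDiv (suc b) Y Y′ → IsDiv a X′ Y′
isDiv-swap a b {X} {Y} {X′} {Y′} Y=X/ X′=X/ Y′=Y/ = <-rec _ step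
  where
  c = suc b
  step : ∀ n → (∀ {i} → i < n → Y′ i ≡ X′ i + shift a Y′ i) → Y′ n ≡ X′ n + shift a Y′ n
  step n ih = begin
    Y′ n
      ≡⟨ Y′=Y/ n ⟩
    Y n + shift c Y′ n
      ≡⟨ cong₂ _+_ (Y=X/ n) (trans (shift-cong-< b n (λ i → ih)) (shift-+ c X′ (shift a Y′) n)) ⟩
    (X n + shift a Y n) + (shift c X′ n + shift c (shift a Y′) n)
      ≡⟨ +-interchange (X n) (shift a Y n) (shift c X′ n) _ ⟩
    (X n + shift c X′ n) + (shift a Y n + shift c (shift a Y′) n)
      ≡⟨ cong₂ _+_ (sym (X′=X/ n)) (cong (shift a Y n +_) (shift-comm c a Y′ n)) ⟩
    X′ n + (shift a Y n + shift a (shift c Y′) n)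
      ≡⟨ cong (X′ n +_) (trans (shift-cong a Y′=Y/ n) (shift-+ a Y (shift c Y′) n)) ⟨
    X′ n + shift a Y′ n
      ∎
    where
    open ≡-Reasoning

isDiv-1-Σ< : {X Y : ℕ → ℕ} → IsDiv 1 X Y → ∀ n → Y n ≡ Σ< (suc n) X
isDiv-1-Σ< {X} Y=X/ zero    = trans (Y=X/ 0) (+-comm (X 0) 0)
isDiv-1-Σ< {X} Y=X/ (suc n) =
  trans (Y=X/ (suc n)) (trans (cong (X (suc n) +_) (isDiv-1-Σ< Y=X/ n)) (+-comm (X (suc n)) _))

-- table F n lists the first n coefficients, highest first; index returns 0 past the end.
table : (ℕ → ℕ) → ℕ → List ℕ
table F zero    = []
table F (suc n) = F n ∷ table F n

table-cong : {F G : ℕ → ℕ} → (∀ i → F i ≡ G i) → ∀ n → table F n ≡ table G n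
table-cong F≗G zero    = refl
table-cong F≗G (suc n) = cong₂ _∷_ (F≗G n) (table-cong F≗G n)

index : List ℕ → ℕ → ℕ
index []       i       = 0
index (x ∷ xs) zero    = x
index (x ∷ xs) (suc i) = index xs i

index-table : (Y : ℕ → ℕ) (n b : ℕ) → index (table Y n) b ≡ shift (suc b) Y n
index-table Y zero    b       = refl
index-table Y (suc n) zero    = refl
index-table Y (suc n) (suc b) = index-table Y n b

divTable : ℕ → List ℕ → List ℕ
divTable b []       = []
divTable b (x ∷ xs) = (x + index (divTable b xs) b) ∷ divTable b xs

Div : ℕ → (ℕ → ℕ) → ℕ → ℕ
Div b F n = F n + index (divTable b (table F n)) b

divTable-table : (b : ℕ) (F : ℕ → ℕ) (n : ℕ) → divTable b (table F n) ≡ table (Div b F) n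
divTable-table b F zero    = refl
divTable-table b F (suc n) = cong (Div b F n ∷_) (divTable-table b F n)

Div-isDiv : (b : ℕ) (F : ℕ → ℕ) → IsDiv (suc b) F (Div b F)
Div-isDiv b F n = cong (F n +_) (trans (cong (λ t → index t b) (divTable-table b F n)) (index-table (Div b F) n b))

-- Partition counts

plist-byLargest : (Q : List ℕ → Bool) (f m n : ℕ) →
  countWhere Q (plist (suc f) m (suc n)) ≡
  ∑[ i < m ] shift (suc i) (λ r → countWhere (Q ∘ (suc i ∷_)) (plist f (suc i) r)) (suc n)
plist-byLargest Q f m n = begin
  countWhere Q (concatMap byLargest (filterᵇ (_≤ᵇ suc n) (map suc (upTo m))))
    ≡⟨ countWhere-concatMap Q byLargest (filterᵇ (_≤ᵇ suc n) (map suc (upTo m))) ⟩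
  sum (map (countWhere Q ∘ byLargest) (filterᵇ (_≤ᵇ suc n) (map suc (upTo m))))
    ≡⟨ sum-map-filterᵇ (_≤ᵇ suc n) (countWhere Q ∘ byLargest) (map suc (upTo m)) ⟩
  sum (map guarded (map suc (upTo m)))
    ≡⟨ cong sum (map-∘ (upTo m)) ⟨
  sum (map (guarded ∘ suc) (upTo m))
    ≡⟨ sum-map-upTo (guarded ∘ suc) m ⟩
  Σ< m (guarded ∘ suc)
    ≡⟨ Σ<-cong m (λ i _ → trans (cong (λ v → if suc i ≤ᵇ suc n then v else 0)
                                      (countWhere-map Q (suc i ∷_) (plist f (suc i) (n ∸ i))))
                                (sym (shift-≤ᵇ (suc i) (rests i) (suc n)))) ⟩
  ∑[ i < m ] shift (suc i) (rests i) (suc n) ∎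
  where
  open ≡-Reasoning
  byLargest : ℕ → List (List ℕ)
  byLargest p = map (p ∷_) (plist f p (suc n ∸ p))
  guarded : ℕ → ℕ
  guarded p = if p ≤ᵇ suc n then countWhere Q (byLargest p) else 0
  rests : ℕ → ℕ → ℕ
  rests i r = countWhere (Q ∘ (suc i ∷_)) (plist f (suc i) r)

Σ<-shift-0 : (m n : ℕ) {Y : ℕ → ℕ → ℕ} → (∀ i → i < m → ∀ r → Y i r ≡ 0) → ∑[ i < m ] shift (suc i) (Y i) n ≡ 0
Σ<-shift-0 m n Y≗0 = trans (Σ<-cong m (λ i i<m → trans (shift-cong (suc i) (Y≗0 i i<m) n) (shift-0 (suc i) n))) (Σ<-zero m)
  where
  shift-0 : ∀ a n → shift a (λ _ → 0) n ≡ 0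
  shift-0 zero    n       = refl
  shift-0 (suc a) zero    = refl
  shift-0 (suc a) (suc n) = shift-0 a n

-- Splitting the partitions of plist by their largest part i + 1 gives the recursion C-suc.
module PlistCount
  (Q : ℕ → List ℕ → Bool) (C : ℕ → ℕ → ℕ → ℕ)
  (C-zero : ∀ m l → C m l 0 ≡ fromBool (Q l []))
  (Q-zero : ∀ p xs → Q 0 (p ∷ xs) ≡ false)
  (C-zero-suc : ∀ m n → C m 0 (suc n) ≡ 0)
  (Q-suc : ∀ l p xs → Q (suc l) (p ∷ xs) ≡ Q l xs)
  (C-suc : ∀ m l n → C m (suc l) (suc n) ≡ ∑[ i < m ] shift (suc i) (C (suc i) l) (suc n))
  where

  countWhere-plist : ∀ f m l n → n ≤ f → countWhere (Q l) (plist f m n) ≡ C m l n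
  countWhere-plist f       m l       zero    _         =
    trans (countWhere-∷ (Q l) [] []) (trans (+-identityʳ _) (sym (C-zero m l)))
  countWhere-plist (suc f) m zero    (suc n) _         = begin
    countWhere (Q 0) (plist (suc f) m (suc n))
      ≡⟨ plist-byLargest (Q 0) f m n ⟩
    ∑[ i < m ] shift (suc i) (λ r → countWhere (Q 0 ∘ (suc i ∷_)) (plist f (suc i) r)) (suc n)
      ≡⟨ Σ<-shift-0 m (suc n) (λ i _ r → trans (countWhere-cong (Q-zero (suc i)) (plist f (suc i) r))
                                                 (countWhere-false (plist f (suc i) r))) ⟩
    0
      ≡⟨ C-zero-suc m n ⟨
    C m 0 (suc n) ∎
    where open ≡-Reasoning
  countWhere-plist (suc f) m (suc l) (suc n) (s≤s n≤f) = begin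
    countWhere (Q (suc l)) (plist (suc f) m (suc n))
      ≡⟨ plist-byLargest (Q (suc l)) f m n ⟩
    ∑[ i < m ] shift (suc i) (λ r → countWhere (Q (suc l) ∘ (suc i ∷_)) (plist f (suc i) r)) (suc n)
      ≡⟨ Σ<-cong m (λ i _ → shift-cong-< i (suc n) (λ r r<1+n → rest i r (≤-trans (≤-pred r<1+n) n≤f))) ⟩
    ∑[ i < m ] shift (suc i) (C (suc i) l) (suc n)
      ≡⟨ C-suc m l n ⟨
    C m (suc l) (suc n) ∎
    where
    open ≡-Reasoning
    rest : ∀ i r → r ≤ f → countWhere (Q (suc l) ∘ (suc i ∷_)) (plist f (suc i) r) ≡ C (suc i) l r
    rest i r r≤f = trans (countWhere-cong (Q-suc l (suc i)) (plist f (suc i) r)) (countWhere-plist f (suc i) l r r≤f)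

δ : ℕ → ℕ
δ zero    = 1
δ (suc n) = 0

-- inBox m l n counts the partitions of n into at most l parts, each at most m;
-- inBoxExact m l n counts those with exactly l parts.
inBox : ℕ → ℕ → ℕ → ℕ
inBox zero    l       n = δ n
inBox (suc m) zero    n = δ n
inBox (suc m) (suc l) n = inBox m (suc l) n + shift (suc m) (inBox (suc m) l) n

inBoxExact : ℕ → ℕ → ℕ → ℕ
inBoxExact zero    zero    n = δ n
inBoxExact zero    (suc l) n = 0
inBoxExact (suc m) zero    n = δ n
inBoxExact (suc m) (suc l) n = inBoxExact m (suc l) n + shift (suc m) (inBoxExact (suc m) l) n

inBox-zero : (m l : ℕ) → inBox m l 0 ≡ 1
inBox-zero zero    l       = refl
inBox-zero (suc m) zero    = refl
inBox-zero (suc m) (suc l) = trans (+-identityʳ _) (inBox-zero m (suc l))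

inBox-noParts : (m n : ℕ) → inBox m 0 n ≡ δ n
inBox-noParts zero    n = refl
inBox-noParts (suc m) n = refl

inBox-byLargest : (m l n : ℕ) → inBox m (suc l) (suc n) ≡ ∑[ i < m ] shift (suc i) (inBox (suc i) l) (suc n)
inBox-byLargest zero    l n = refl
inBox-byLargest (suc m) l n = cong (_+ shift (suc m) (inBox (suc m) l) (suc n)) (inBox-byLargest m l n)

inBoxExact-zero : (m l : ℕ) → inBoxExact m l 0 ≡ fromBool (0 ≡ᵇ l)
inBoxExact-zero zero    zero    = refl
inBoxExact-zero zero    (suc l) = refl
inBoxExact-zero (suc m) zero    = refl
inBoxExact-zero (suc m) (suc l) = trans (+-identityʳ _) (inBoxExact-zero m (suc l))

inBoxExact-noParts : (m n : ℕ) → inBoxExact m 0 (suc n) ≡ 0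
inBoxExact-noParts zero    n = refl
inBoxExact-noParts (suc m) n = refl

inBoxExact-byLargest : (m l n : ℕ) →
  inBoxExact m (suc l) (suc n) ≡ ∑[ i < m ] shift (suc i) (inBoxExact (suc i) l) (suc n)
inBoxExact-byLargest zero    l n = refl
inBoxExact-byLargest (suc m) l n = cong (_+ shift (suc m) (inBoxExact (suc m) l) (suc n)) (inBoxExact-byLargest m l n)

suc-≤ᵇ-suc : (a l : ℕ) → (suc a ≤ᵇ suc l) ≡ (a ≤ᵇ l)
suc-≤ᵇ-suc zero    l = refl
suc-≤ᵇ-suc (suc a) l = refl

module AtMost  = PlistCount (λ l xs → length xs ≤ᵇ l) inBox inBox-zero (λ _ _ → refl) (λ m n → inBox-noParts m (suc n))
                            (λ l _ xs → suc-≤ᵇ-suc (length xs) l) inBox-byLargest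
module Exactly = PlistCount (λ l xs → length xs ≡ᵇ l) inBoxExact inBoxExact-zero (λ _ _ → refl) inBoxExact-noParts
                            (λ _ _ _ → refl) inBoxExact-byLargest

inBox-suc : (m l n : ℕ) → inBox m (suc l) n ≡ inBox m l n + inBoxExact m (suc l) n
inBox-suc zero    l       n = sym (+-identityʳ _)
inBox-suc (suc m) zero    n = begin
  inBox m 1 n + shift (suc m) δ n                     ≡⟨ cong (_+ shift (suc m) δ n) (inBox-suc m 0 n) ⟩
  (inBox m 0 n + inBoxExact m 1 n) + shift (suc m) δ n ≡⟨ cong (λ v → (v + inBoxExact m 1 n) + shift (suc m) δ n) (inBox-noParts m n) ⟩
  (δ n + inBoxExact m 1 n) + shift (suc m) δ n         ≡⟨ +-assoc (δ n) _ _ ⟩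
  δ n + inBoxExact (suc m) 1 n                         ∎
  where open ≡-Reasoning
inBox-suc (suc m) (suc l) n = begin
  inBox m (suc (suc l)) n + shift (suc m) (inBox (suc m) (suc l)) n
    ≡⟨ cong₂ _+_ (inBox-suc m (suc l) n)
                 (trans (shift-cong (suc m) (inBox-suc (suc m) l) n) (shift-+ (suc m) _ _ n)) ⟩
  (inBox m (suc l) n + inBoxExact m (suc (suc l)) n) +
  (shift (suc m) (inBox (suc m) l) n + shift (suc m) (inBoxExact (suc m) (suc l)) n)
    ≡⟨ +-interchange (inBox m (suc l) n) _ _ _ ⟩
  (inBox m (suc l) n + shift (suc m) (inBox (suc m) l) n) +
  (inBoxExact m (suc (suc l)) n + shift (suc m) (inBoxExact (suc m) (suc l)) n)
    ∎
  where
  open ≡-Reasoning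

-- Removing the first column of the Ferrers diagram.
inBoxExact-suc : (m l n : ℕ) → inBoxExact (suc m) (suc l) n ≡ shift (suc l) (inBox m (suc l)) n
inBoxExact-suc zero    zero    n = refl
inBoxExact-suc zero    (suc l) n = trans (shift-cong 1 (inBoxExact-suc zero l) n) (shift-shift 1 (suc l) δ n)
inBoxExact-suc (suc m) zero    n = begin
  inBoxExact (suc m) 1 n + shift (suc (suc m)) δ n ≡⟨ cong₂ _+_ (inBoxExact-suc m 0 n) (sym (shift-shift 1 (suc m) δ n)) ⟩
  shift 1 (inBox m 1) n + shift 1 (shift (suc m) δ) n  ≡⟨ shift-+ 1 _ _ n ⟨
  shift 1 (inBox (suc m) 1) n                          ∎
  where open ≡-Reasoning
inBoxExact-suc (suc m) (suc l) n = begin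
  inBoxExact (suc m) (suc (suc l)) n + shift (suc (suc m)) (inBoxExact (suc (suc m)) (suc l)) n
    ≡⟨ cong₂ _+_ (inBoxExact-suc m (suc l) n)
                 (trans (shift-cong (suc (suc m)) (inBoxExact-suc (suc m) l) n) shifts-commute) ⟩
  shift (suc (suc l)) (inBox m (suc (suc l))) n + shift (suc (suc l)) (shift (suc m) (inBox (suc m) (suc l))) n
    ≡⟨ shift-+ (suc (suc l)) _ _ n ⟨
  shift (suc (suc l)) (inBox (suc m) (suc (suc l))) n ∎
  where
  open ≡-Reasoning
  shifts-commute : shift (suc (suc m)) (shift (suc l) (inBox (suc m) (suc l))) n
                 ≡ shift (suc (suc l)) (shift (suc m) (inBox (suc m) (suc l))) n
  shifts-commute = begin
    shift (suc (suc m)) (shift (suc l) Y) n ≡⟨ shift-shift (suc (suc m)) (suc l) Y n ⟩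
    shift (suc (suc m) + suc l) Y n         ≡⟨ cong (λ c → shift (suc (suc c)) Y n) m+1+l≡l+1+m ⟩
    shift (suc (suc l) + suc m) Y n         ≡⟨ shift-shift (suc (suc l)) (suc m) Y n ⟨
    shift (suc (suc l)) (shift (suc m) Y) n ∎
    where
    Y = inBox (suc m) (suc l)
    m+1+l≡l+1+m : m + suc l ≡ l + suc m
    m+1+l≡l+1+m = trans (+-suc m l) (trans (cong suc (+-comm m l)) (sym (+-suc l m)))

inBox-suc-stable : (m l n : ℕ) → n ≤ m → inBox (suc m) l n ≡ inBox m l n
inBox-suc-stable m zero    n n≤m = sym (inBox-noParts m n)
inBox-suc-stable m (suc l) n n≤m =
  trans (cong (inBox m (suc l) n +_) (shift-< (suc m) _ n (s≤s n≤m))) (+-identityʳ _)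

inBox-stable : (m l n : ℕ) → n ≤ m → inBox m l n ≡ inBox n l n
inBox-stable m l n n≤m = trans (cong (λ z → inBox z l n) (sym (m∸n+n≡m n≤m))) (lift (m ∸ n))
  where
  lift : (d : ℕ) → inBox (d + n) l n ≡ inBox n l n
  lift zero    = refl
  lift (suc d) = trans (inBox-suc-stable (d + n) l n (m≤n+m n d)) (lift d)

-- P k = 1/(q;q)_k and E k = q^k/(q;q)_k count the partitions with at most, respectively
-- exactly, k parts; R k counts those with exactly k parts whose largest part is repeated.
P : ℕ → ℕ → ℕ
P k n = inBox n k n

E : ℕ → ℕ → ℕ
E k n = inBoxExact n k n

countPartitions : (List ℕ → Bool) → ℕ → ℕ
countPartitions p n = countWhere p (Partitions n)

R : ℕ → ℕ → ℕ
R k = countPartitions (λ β → (length β ≡ᵇ k) ∧ largestRepeated β)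

countPartitions-P : (k n : ℕ) → countPartitions (λ α → length α ≤ᵇ k) n ≡ P k n
countPartitions-P k n = AtMost.countWhere-plist n n k n ≤-refl

countPartitions-E : (k n : ℕ) → countPartitions (λ α → length α ≡ᵇ k) n ≡ E k n
countPartitions-E k n = Exactly.countWhere-plist n n k n ≤-refl

E-shift-P : (k n : ℕ) → E (suc k) n ≡ shift (suc k) (P (suc k)) n
E-shift-P k zero    = refl
E-shift-P k (suc n) = trans (inBoxExact-suc n k (suc n))
  (shift-cong-< k (suc n) (λ i i<1+n → inBox-stable n (suc k) i (≤-pred i<1+n)))

P-isDiv : (k : ℕ) → IsDiv (suc k) (P k) (P (suc k))
P-isDiv k zero    = refl
P-isDiv k (suc n) = trans (inBox-suc (suc n) k (suc n)) (cong (P k (suc n) +_) (E-shift-P k (suc n)))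

P-one : (n : ℕ) → P 1 n ≡ 1
P-one zero    = refl
P-one (suc n) = trans (P-isDiv 0 (suc n)) (P-one n)

count-∷-self : (p : ℕ) (xs : List ℕ) → count p (p ∷ xs) ≡ suc (count p xs)
count-∷-self p xs = trans (countWhere-∷ (_≡ᵇ p) p xs)
                          (cong (λ b → fromBool b + count p xs) (Equivalence.to T-≡ (≡⇒≡ᵇ p p refl)))

count-∷-< : (x p : ℕ) (xs : List ℕ) → x < p → count p (x ∷ xs) ≡ count p xs
count-∷-< x p xs x<p = trans (countWhere-∷ (_≡ᵇ p) x xs) (cong (λ b → fromBool b + count p xs) (≡ᵇ-false x p x<p))
  where
  ≡ᵇ-false : ∀ x p → x < p → (x ≡ᵇ p) ≡ false
  ≡ᵇ-false zero    (suc p) _         = refl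
  ≡ᵇ-false (suc x) (suc p) (s≤s x<p) = ≡ᵇ-false x p x<p

plist-lacks : (f m M p : ℕ) → m < p → countWhere (λ xs → 0 <ᵇ count p xs) (plist f m M) ≡ 0
plist-lacks f       m zero    p m<p = refl
plist-lacks zero    m (suc M) p m<p = refl
plist-lacks (suc f) m (suc M) p m<p = trans (plist-byLargest has-p f m M) (Σ<-shift-0 m (suc M) none)
  where
  has-p : List ℕ → Bool
  has-p xs = 0 <ᵇ count p xs
  none : ∀ i → i < m → ∀ r → countWhere (has-p ∘ (suc i ∷_)) (plist f (suc i) r) ≡ 0
  none i i<m r = trans (countWhere-cong (λ xs → cong (0 <ᵇ_) (count-∷-< (suc i) p xs 1+i<p)) (plist f (suc i) r))
                       (plist-lacks f (suc i) r p 1+i<p)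
    where 1+i<p = <-≤-trans (s≤s i<m) m<p

containing : ℕ → ℕ → List ℕ → Bool
containing p l xs = (length xs ≡ᵇ l) ∧ (0 <ᵇ count p xs)

-- A partition with parts ≤ i + 1 containing i + 1 starts with i + 1; removing that part is the bijection.
plist-containing : (f i j M : ℕ) → M ≤ f →
  countWhere (containing (suc i) (suc j)) (plist f (suc i) M) ≡ shift (suc i) (inBoxExact (suc i) j) M
plist-containing f       i j zero    _         = refl
plist-containing (suc f) i j (suc M) (s≤s M≤f) =
  trans (plist-byLargest Q f (suc i) M) (trans (cong₂ _+_ smaller largest) (+-identityˡ _))
  where
  Q = containing (suc i) (suc j)
  smaller : ∑[ i′ < i ] shift (suc i′) (λ r → countWhere (Q ∘ (suc i′ ∷_)) (plist f (suc i′) r)) (suc M) ≡ 0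
  smaller = Σ<-shift-0 i (suc M) none
    where
    none : ∀ i′ → i′ < i → ∀ r → countWhere (Q ∘ (suc i′ ∷_)) (plist f (suc i′) r) ≡ 0
    none i′ i′<i r = n≤0⇒n≡0 (begin
      countWhere (Q ∘ (suc i′ ∷_)) (plist f (suc i′) r)
        ≡⟨ countWhere-cong (λ xs → cong (λ c → (length xs ≡ᵇ j) ∧ (0 <ᵇ c)) (count-∷-< (suc i′) (suc i) xs (s≤s i′<i)))
                           (plist f (suc i′) r) ⟩
      countWhere (λ xs → (length xs ≡ᵇ j) ∧ (0 <ᵇ count (suc i) xs)) (plist f (suc i′) r)
        ≤⟨ countWhere-∧-≤ (λ xs → length xs ≡ᵇ j) (λ xs → 0 <ᵇ count (suc i) xs) (plist f (suc i′) r) ⟩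
      countWhere (λ xs → 0 <ᵇ count (suc i) xs) (plist f (suc i′) r)
        ≡⟨ plist-lacks f (suc i′) r (suc i) (s≤s i′<i) ⟩
      0 ∎)
      where open ≤-Reasoning
  largest : shift (suc i) (λ r → countWhere (Q ∘ (suc i ∷_)) (plist f (suc i) r)) (suc M)
          ≡ shift (suc i) (inBoxExact (suc i) j) (suc M)
  largest = shift-cong-< i (suc M) (λ r r<1+M →
    trans (countWhere-cong (λ xs → trans (cong (λ c → (length xs ≡ᵇ j) ∧ (0 <ᵇ c)) (count-∷-self (suc i) xs))
                                         (∧-identityʳ (length xs ≡ᵇ j)))
                           (plist f (suc i) r))
          (Exactly.countWhere-plist f (suc i) j r (≤-trans (≤-pred r<1+M) M≤f)))

R-byLargest : (j n : ℕ) →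
  R (2 + j) (suc n) ≡ ∑[ i < suc n ] shift (suc i) (shift (suc i) (inBoxExact (suc i) j)) (suc n)
R-byLargest j n = trans (plist-byLargest _ n (suc n) n) (Σ<-cong (suc n) (λ i _ → shift-cong-< i (suc n) (λ r r<1+n →
  trans (countWhere-cong (λ β → cong (λ c → (length β ≡ᵇ suc j) ∧ (2 ≤ᵇ c)) (count-∷-self (suc i) β)) (plist n (suc i) r))
        (plist-containing n i j r (≤-pred r<1+n)))))

-- A partition with exactly k parts whose largest part is not repeated comes from one of n − 1
-- with exactly k parts by raising its largest part.
E-isDiv-R : (j : ℕ) → IsDiv 1 (R (2 + j)) (E (2 + j))
E-isDiv-R j zero    = refl
E-isDiv-R j (suc n) = begin
  inBoxExact (suc n) k (suc n)
    ≡⟨ inBoxExact-byLargest (suc n) (suc j) n ⟩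
  ∑[ i < suc n ] shift (suc i) (inBoxExact (suc i) (suc j)) (suc n)
    ≡⟨ Σ<-cong (suc n) (λ i _ → shift-+ (suc i) (inBoxExact i (suc j)) (shift (suc i) (inBoxExact (suc i) j)) (suc n)) ⟩
  ∑[ i < suc n ] (shift i (inBoxExact i (suc j)) n + shift (suc i) (shift (suc i) (inBoxExact (suc i) j)) (suc n))
    ≡⟨ Σ<-+ (suc n) _ _ ⟩
  ∑[ i < suc n ] shift i (inBoxExact i (suc j)) n + ∑[ i < suc n ] shift (suc i) (shift (suc i) (inBoxExact (suc i) j)) (suc n)
    ≡⟨ cong₂ _+_ (trans (Σ<-suc n _) (E-byLargest n)) (sym (R-byLargest j n)) ⟩
  E k n + R k (suc n)
    ≡⟨ +-comm (E k n) (R k (suc n)) ⟩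
  R k (suc n) + E k n ∎
  where
  open ≡-Reasoning
  k = 2 + j
  E-byLargest : ∀ n → ∑[ i < n ] shift (suc i) (inBoxExact (suc i) (suc j)) n ≡ E k n
  E-byLargest zero    = refl
  E-byLargest (suc n) = sym (inBoxExact-byLargest (suc n) (suc j) n)

countWhere-PartitionPairs : (p q : List ℕ → Bool) (n : ℕ) →
  countWhere (λ αβ → p (proj₁ αβ) ∧ q (proj₂ αβ)) (PartitionPairs n) ≡ conv (countPartitions p) (countPartitions q) n
countWhere-PartitionPairs p q n = begin
  countWhere r (concatMap pairs (upTo (suc n)))        ≡⟨ countWhere-concatMap r pairs (upTo (suc n)) ⟩
  sum (map (countWhere r ∘ pairs) (upTo (suc n)))      ≡⟨ sum-map-upTo (countWhere r ∘ pairs) (suc n) ⟩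
  Σ< (suc n) (countWhere r ∘ pairs)
    ≡⟨ Σ<-cong (suc n) (λ a _ → countWhere-cartesianProduct p q (Partitions a) (Partitions (n ∸ a))) ⟩
  conv (countPartitions p) (countPartitions q) n ∎
  where
  open ≡-Reasoning
  r = λ αβ → p (proj₁ αβ) ∧ q (proj₂ αβ)
  pairs = λ a → cartesianProduct (Partitions a) (Partitions (n ∸ a))

G : ℕ → ℕ → ℕ
G k = conv (P k) (P k)

g≡G : (k n : ℕ) → g k n ≡ G k n
g≡G k n = begin
  g k n
    ≡⟨ countWhere-cong (λ { (α , β) → refl }) (PartitionPairs n) ⟩
  countWhere (λ αβ → atMost (proj₁ αβ) ∧ atMost (proj₂ αβ)) (PartitionPairs n)
    ≡⟨ countWhere-PartitionPairs atMost atMost n ⟩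
  conv (countPartitions atMost) (countPartitions atMost) n
    ≡⟨ trans (conv-congˡ (countPartitions-P k) (countPartitions atMost) n) (conv-congʳ (P k) (countPartitions-P k) n) ⟩
  G k n ∎
  where
  open ≡-Reasoning
  atMost = λ (α : List ℕ) → length α ≤ᵇ k

h≡conv-E-R : (j n : ℕ) → h (2 + j) n ≡ conv (E (2 + j)) (R (2 + j)) n
h≡conv-E-R j n = begin
  h (2 + j) n
    ≡⟨ countWhere-cong (λ { (α , β) → refl }) (PartitionPairs n) ⟩
  countWhere (λ αβ → exactly (proj₁ αβ) ∧ repeated (proj₂ αβ)) (PartitionPairs n)
    ≡⟨ countWhere-PartitionPairs exactly repeated n ⟩
  conv (countPartitions exactly) (R (2 + j)) n
    ≡⟨ conv-congˡ (countPartitions-E (2 + j)) (R (2 + j)) n ⟩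
  conv (E (2 + j)) (R (2 + j)) n ∎
  where
  open ≡-Reasoning
  exactly = λ (α : List ℕ) → length α ≡ᵇ 2 + j
  repeated = λ (β : List ℕ) → (length β ≡ᵇ 2 + j) ∧ largestRepeated β

-- D k = (1 − q)/(q;q)_k², built as D 1 = 1/(1 − q) and D (k + 1) = D k/(1 − q^(k+1))²;
-- D 0 is never used.
D : ℕ → ℕ → ℕ
D zero          = λ _ → 1
D (suc zero)    = λ _ → 1
D (suc (suc k)) = Div (suc k) (Div (suc k) (D (suc k)))

-- The series halfway from index k + 1 to k + 2: D (k + 1)/(1 − q^(k+2)) and P (k + 2) P (k + 1).
Dhalf : ℕ → ℕ → ℕ
Dhalf k = Div (suc k) (D (suc k))

Ghalf : ℕ → ℕ → ℕ
Ghalf k = conv (P (2 + k)) (P (suc k))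

G-isDiv-Ghalf : (k : ℕ) → IsDiv (2 + k) (G (suc k)) (Ghalf k)
G-isDiv-Ghalf k = conv-isDivˡ (2 + k) (P (suc k)) (P-isDiv (suc k))

Ghalf-isDiv-G : (k : ℕ) → IsDiv (2 + k) (Ghalf k) (G (2 + k))
Ghalf-isDiv-G k = conv-isDivʳ (2 + k) (P (2 + k)) (P-isDiv (suc k))

G-one : (n : ℕ) → G 1 n ≡ suc n
G-one n = trans (Σ<-cong (suc n) (λ i _ → cong₂ _*_ (P-one i) (P-one (n ∸ i)))) (Σ<-one (suc n))

G-isDiv-D : (k : ℕ) → IsDiv 1 (D (suc k)) (G (suc k))
G-isDiv-D zero    zero    = G-one 0
G-isDiv-D zero    (suc n) = trans (G-one (suc n)) (cong suc (sym (G-one n)))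
G-isDiv-D (suc k) = isDiv-swap 1 (suc k) half (Div-isDiv (suc k) (Dhalf k)) (Ghalf-isDiv-G k)
  where
  half : IsDiv 1 (Dhalf k) (Ghalf k)
  half = isDiv-swap 1 (suc k) (G-isDiv-D k) (Div-isDiv (suc k) (D (suc k))) (G-isDiv-Ghalf k)

G-Σ<-D : (k n : ℕ) → G (suc k) n ≡ Σ< (suc n) (D (suc k))
G-Σ<-D k = isDiv-1-Σ< (G-isDiv-D k)

conv-E-E : (k n : ℕ) → conv (E (suc k)) (E (suc k)) n ≡ shift (suc k + suc k) (G (suc k)) n
conv-E-E k n = begin
  conv (E k₁) (E k₁) n
    ≡⟨ trans (conv-congˡ (E-shift-P k) (E k₁) n) (conv-congʳ (shift k₁ (P k₁)) (E-shift-P k) n) ⟩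
  conv (shift k₁ (P k₁)) (shift k₁ (P k₁)) n ≡⟨ conv-shiftˡ k₁ (P k₁) (shift k₁ (P k₁)) n ⟩
  shift k₁ (conv (P k₁) (shift k₁ (P k₁))) n ≡⟨ shift-cong k₁ (conv-shiftʳ k₁ (P k₁) (P k₁)) n ⟩
  shift k₁ (shift k₁ (G k₁)) n               ≡⟨ shift-shift k₁ k₁ (G k₁) n ⟩
  shift (k₁ + k₁) (G k₁) n                   ∎
  where
  open ≡-Reasoning
  k₁ = suc k

-- E (R + q E) = E E = q^(2k) G = q^(2k) D + q · q^(2k) G, and cancelling q · E E = q · q^(2k) G
-- leaves E R = q^(2k) D.
h≡shift-D : (j n : ℕ) → h (2 + j) n ≡ shift (2 + j + (2 + j)) (D (2 + j)) n
h≡shift-D j n = trans (h≡conv-E-R j n) (+-cancelʳ-≡ (shift 1 (conv (E k) (E k)) n) _ _ (begin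
  conv (E k) (R k) n + shift 1 (conv (E k) (E k)) n     ≡⟨ cong (conv (E k) (R k) n +_) (conv-shiftʳ 1 (E k) (E k) n) ⟨
  conv (E k) (R k) n + conv (E k) (shift 1 (E k)) n     ≡⟨ conv-+ʳ (E k) (R k) (shift 1 (E k)) n ⟨
  conv (E k) (λ m → R k m + shift 1 (E k) m) n          ≡⟨ conv-congʳ (E k) (E-isDiv-R j) n ⟨
  conv (E k) (E k) n                                    ≡⟨ conv-E-E (suc j) n ⟩
  shift kk (G k) n                                      ≡⟨ shift-cong kk (G-isDiv-D (suc j)) n ⟩
  shift kk (λ m → D k m + shift 1 (G k) m) n            ≡⟨ shift-+ kk (D k) (shift 1 (G k)) n ⟩
  shift kk (D k) n + shift kk (shift 1 (G k)) n         ≡⟨ cong (shift kk (D k) n +_) (shift-comm kk 1 (G k) n) ⟩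
  shift kk (D k) n + shift 1 (shift kk (G k)) n         ≡⟨ cong (shift kk (D k) n +_) (shift-cong 1 (conv-E-E (suc j)) n) ⟨
  shift kk (D k) n + shift 1 (conv (E k) (E k)) n       ∎))
  where
  open ≡-Reasoning
  k = 2 + j
  kk = k + k

-- Growth of quotient series

Monotone : (ℕ → ℕ) → Set
Monotone Y = ∀ n → Y n ≤ Y (suc n)

Dominates : ℕ → ℕ → (ℕ → ℕ) → (ℕ → ℕ) → Set
Dominates c s Y X = ∀ n → c * Y n ≤ X (n + s)

GrowthBound : ℕ → (ℕ → ℕ) → Set
GrowthBound c Y = ∀ m → m * Y m ≤ c * Σ< m Y

monotone-+ : {X : ℕ → ℕ} → Monotone X → ∀ a j → X j ≤ X (a + j)
monotone-+ mono zero    j = ≤-refl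
monotone-+ mono (suc a) j = ≤-trans (monotone-+ mono a j) (mono (a + j))

shift-suc-≤ : (Y : ℕ → ℕ) (a n : ℕ) → (∀ i → i < n → Y i ≤ Y (suc i)) → shift (suc a) Y n ≤ shift a Y n
shift-suc-≤ Y zero    zero    mono = z≤n
shift-suc-≤ Y zero    (suc n) mono = mono n ≤-refl
shift-suc-≤ Y (suc a) zero    mono = z≤n
shift-suc-≤ Y (suc a) (suc n) mono = shift-suc-≤ Y a n (λ i i<n → mono i (m<n⇒m<1+n i<n))

shift-≤ : (a : ℕ) (Z T : ℕ → ℕ) (n : ℕ) → (∀ i → a + i ≤ n → Z i ≤ T (a + i)) → shift a Z n ≤ T n
shift-≤ zero    Z T n       bound = bound n ≤-refl
shift-≤ (suc a) Z T zero    bound = z≤n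
shift-≤ (suc a) Z T (suc n) bound = shift-≤ a Z (T ∘ suc) n (λ i a+i≤n → bound i (s≤s a+i≤n))

*-shift-index : (a m : ℕ) (Y : ℕ → ℕ) → m * shift a Y m ≡ shift a (λ i → (a + i) * Y i) m
*-shift-index zero    m       Y = refl
*-shift-index (suc a) zero    Y = refl
*-shift-index (suc a) (suc m) Y =
  trans (cong (shift a Y m +_) (*-shift-index a m Y)) (sym (shift-+ a Y (λ i → (a + i) * Y i) m))

Σ<-shift : (a : ℕ) (Y : ℕ → ℕ) (m : ℕ) → Σ< m (shift a Y) ≡ shift a (λ j → Σ< j Y) m
Σ<-shift zero    Y m       = refl
Σ<-shift (suc a) Y zero    = refl
Σ<-shift (suc a) Y (suc m) = trans (Σ<-suc m (shift (suc a) Y)) (Σ<-shift a Y m)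

Σ<-isDiv : (a : ℕ) {X Y : ℕ → ℕ} → IsDiv a X Y → ∀ m → Σ< m Y ≡ Σ< m X + shift a (λ j → Σ< j Y) m
Σ<-isDiv a {X} {Y} Y=X/ m = trans (Σ<-cong m (λ i _ → Y=X/ i)) (trans (Σ<-+ m X (shift a Y)) (cong (Σ< m X +_) (Σ<-shift a Y m)))

isDiv-monotone : (b : ℕ) {X Y : ℕ → ℕ} → IsDiv (suc b) X Y → Monotone X → Monotone Y
isDiv-monotone b {X} {Y} Y=X/ mono = <-rec _ λ n ih →
  subst₂ _≤_ (sym (Y=X/ n)) (sym (Y=X/ (suc n))) (+-mono-≤ (mono n) (shift-suc-≤ Y b n (λ i → ih)))

Σ<-monotone : {X : ℕ → ℕ} → Monotone X → ∀ a j → a * X j + Σ< j X ≤ Σ< (a + j) X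
Σ<-monotone         mono zero    j = ≤-refl
Σ<-monotone {X = X} mono (suc a) j = begin
  (X j + a * X j) + Σ< j X ≡⟨ +-assoc (X j) (a * X j) (Σ< j X) ⟩
  X j + (a * X j + Σ< j X) ≤⟨ +-mono-≤ (monotone-+ mono a j) (Σ<-monotone mono a j) ⟩
  X (a + j) + Σ< (a + j) X ≡⟨ +-comm (X (a + j)) _ ⟩
  Σ< (a + j) X + X (a + j) ∎
  where open ≤-Reasoning

isDiv-≤-Σ< : (b : ℕ) {X Y : ℕ → ℕ} → IsDiv (suc b) X Y → Monotone X → ∀ j → suc b * Y j ≤ Σ< (suc b + j) X
isDiv-≤-Σ< b {X} {Y} Y=X/ mono = <-rec _ step
  where
  a = suc b
  step : ∀ j → (∀ {i} → i < j → a * Y i ≤ Σ< (a + i) X) → a * Y j ≤ Σ< (a + j) X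
  step j ih = begin
    a * Y j                             ≡⟨ cong (a *_) (Y=X/ j) ⟩
    a * (X j + shift a Y j)             ≡⟨ *-distribˡ-+ a (X j) _ ⟩
    a * X j + a * shift a Y j           ≡⟨ cong (a * X j +_) (*-shift a a Y j) ⟩
    a * X j + shift a (λ i → a * Y i) j
      ≤⟨ +-monoʳ-≤ (a * X j) (shift-≤ a _ (λ n → Σ< n X) j (λ i a+i≤j → ih (<-≤-trans (m<n+m i z<s) a+i≤j))) ⟩
    a * X j + Σ< j X                    ≤⟨ Σ<-monotone mono a j ⟩
    Σ< (a + j) X                        ∎
    where open ≤-Reasoning

isDiv-growth : (b c : ℕ) {X Y : ℕ → ℕ} → IsDiv (suc b) X Y → Monotone X → GrowthBound c X → GrowthBound (suc c) Y
isDiv-growth b c {X} {Y} Y=X/ mono growth = <-rec _ step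
  where
  a = suc b
  SY : ℕ → ℕ
  SY j = Σ< j Y
  step : ∀ m → (∀ {i} → i < m → i * Y i ≤ suc c * SY i) → m * Y m ≤ suc c * SY m
  step m ih = begin
    m * Y m
      ≡⟨ cong (m *_) (Y=X/ m) ⟩
    m * (X m + shift a Y m)
      ≡⟨ *-distribˡ-+ m (X m) _ ⟩
    m * X m + m * shift a Y m
      ≡⟨ cong (m * X m +_) (*-shift-index a m Y) ⟩
    m * X m + shift a (λ i → (a + i) * Y i) m
      ≤⟨ +-mono-≤ (growth m) (shift-≤ a _ (λ n → suc c * shift a SY n + Σ< n X) m earlier) ⟩
    c * Σ< m X + (suc c * shift a SY m + Σ< m X)
      ≡⟨ regroup c (Σ< m X) (shift a SY m) ⟩
    suc c * (Σ< m X + shift a SY m)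
      ≡⟨ cong (suc c *_) (Σ<-isDiv a Y=X/ m) ⟨
    suc c * SY m ∎
    where
    open ≤-Reasoning
    regroup : ∀ c x y → c * x + (suc c * y + x) ≡ suc c * (x + y)
    regroup = solve-∀
    earlier : ∀ i → a + i ≤ m → (a + i) * Y i ≤ suc c * shift a SY (a + i) + Σ< (a + i) X
    earlier i a+i≤m = begin
      (a + i) * Y i                          ≡⟨ *-distribʳ-+ (Y i) a i ⟩
      a * Y i + i * Y i                      ≤⟨ +-mono-≤ (isDiv-≤-Σ< b Y=X/ mono i) (ih (<-≤-trans (m<n+m i z<s) a+i≤m)) ⟩
      Σ< (a + i) X + suc c * SY i            ≡⟨ +-comm (Σ< (a + i) X) (suc c * SY i) ⟩
      suc c * SY i + Σ< (a + i) X            ≡⟨ cong (λ v → suc c * v + Σ< (a + i) X) (shift-+ˡ a SY i) ⟨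
      suc c * shift a SY (a + i) + Σ< (a + i) X ∎

shift-≤-offset : (Z W : ℕ → ℕ) (a n s : ℕ) → (∀ i → a + i ≤ n → Z i ≤ W (i + s)) → shift a Z n ≤ shift a W (n + s)
shift-≤-offset Z W zero    n       s bound = bound n ≤-refl
shift-≤-offset Z W (suc a) zero    s bound = z≤n
shift-≤-offset Z W (suc a) (suc n) s bound = shift-≤-offset Z W a n s (λ i a+i≤n → bound i (s≤s a+i≤n))

isDiv-dominates : (b c s : ℕ) {X Y X′ Y′ : ℕ → ℕ} → IsDiv (suc b) Y Y′ → IsDiv (suc b) X X′ →
                  Dominates c s Y X → Dominates c s Y′ X′
isDiv-dominates b c s {X} {Y} {X′} {Y′} Y′=Y/ X′=X/ dom = <-rec _ step
  where
  step : ∀ n → (∀ {i} → i < n → c * Y′ i ≤ X′ (i + s)) → c * Y′ n ≤ X′ (n + s)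
  step n ih = begin
    c * Y′ n                               ≡⟨ cong (c *_) (Y′=Y/ n) ⟩
    c * (Y n + shift (suc b) Y′ n)         ≡⟨ *-distribˡ-+ c (Y n) _ ⟩
    c * Y n + c * shift (suc b) Y′ n       ≡⟨ cong (c * Y n +_) (*-shift c (suc b) Y′ n) ⟩
    c * Y n + shift (suc b) (λ i → c * Y′ i) n
      ≤⟨ +-mono-≤ (dom n) (shift-≤-offset _ X′ (suc b) n s (λ i 1+b+i≤n → ih (<-≤-trans (m<n+m i z<s) 1+b+i≤n))) ⟩
    X (n + s) + shift (suc b) X′ (n + s)   ≡⟨ X′=X/ (n + s) ⟨
    X′ (n + s)                             ∎
    where open ≤-Reasoning

D-monotone : (k : ℕ) → Monotone (D (suc k))
D-monotone zero    n = ≤-refl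
D-monotone (suc k) =
  isDiv-monotone (suc k) (Div-isDiv (suc k) (Dhalf k)) (isDiv-monotone (suc k) (Div-isDiv (suc k) (D (suc k))) (D-monotone k))

D-growth : (k : ℕ) → GrowthBound (suc (2 * k)) (D (suc k))
D-growth zero    m = ≤-reflexive (trans (*-identityʳ m) (sym (trans (+-identityʳ _) (Σ<-one m))))
D-growth (suc k) = subst (λ c → GrowthBound c (D (2 + k))) (cong suc (sym (*-suc 2 k)))
  (isDiv-growth (suc k) (suc (suc (2 * k))) (Div-isDiv (suc k) (Dhalf k))
                (isDiv-monotone (suc k) (Div-isDiv (suc k) (D (suc k))) (D-monotone k))
                (isDiv-growth (suc k) (suc (2 * k)) (Div-isDiv (suc k) (D (suc k))) (D-monotone k) (D-growth k)))

-- Split 21 · D m as (s + 1) · D m, absorbed by the last s + 1 terms of G (m + s) = Σ_{i ≤ m + s} D i,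
-- plus t · D m, absorbed by the first m terms thanks to the growth bound.
D-dominated-large : (k s t : ℕ) → 21 ≡ suc s + t → ∀ m → t * suc (2 * k) ≤ m → 21 * D (suc k) m ≤ G (suc k) (m + s)
D-dominated-large k s t 21≡ m t·c≤m = begin
  21 * Dₘ                    ≡⟨ cong (_* Dₘ) 21≡ ⟩
  (suc s + t) * Dₘ           ≡⟨ *-distribʳ-+ Dₘ (suc s) t ⟩
  suc s * Dₘ + t * Dₘ        ≤⟨ +-monoʳ-≤ (suc s * Dₘ) t·Dₘ≤ΣD ⟩
  suc s * Dₘ + Σ< m Dk       ≤⟨ Σ<-monotone (D-monotone k) (suc s) m ⟩
  Σ< (suc s + m) Dk          ≡⟨ cong (λ v → Σ< (suc v) Dk) (+-comm s m) ⟩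
  Σ< (suc (m + s)) Dk        ≡⟨ G-Σ<-D k (m + s) ⟨
  G (suc k) (m + s)          ∎
  where
  open ≤-Reasoning
  Dk = D (suc k)
  Dₘ = Dk m
  c = suc (2 * k)
  t·Dₘ≤ΣD : t * Dₘ ≤ Σ< m Dk
  t·Dₘ≤ΣD = *-cancelˡ-≤ c (begin
    c * (t * Dₘ) ≡⟨ *-assoc c t Dₘ ⟨
    (c * t) * Dₘ ≡⟨ cong (_* Dₘ) (*-comm c t) ⟩
    (t * c) * Dₘ ≤⟨ *-monoˡ-≤ Dₘ t·c≤m ⟩
    m * Dₘ       ≤⟨ D-growth k m ⟩
    c * Σ< m Dk  ∎)

-- Finitely many coefficients by computation

Dtable : ℕ → ℕ → List ℕ
Dtable zero          N = table (λ _ → 1) N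
Dtable (suc zero)    N = table (λ _ → 1) N
Dtable (suc (suc k)) N = divTable (suc k) (divTable (suc k) (Dtable (suc k) N))

Dtable-table : (k N : ℕ) → Dtable k N ≡ table (D k) N
Dtable-table zero          N = refl
Dtable-table (suc zero)    N = refl
Dtable-table (suc (suc k)) N = begin
  divTable (suc k) (divTable (suc k) (Dtable (suc k) N))
    ≡⟨ cong (divTable (suc k) ∘ divTable (suc k)) (Dtable-table (suc k) N) ⟩
  divTable (suc k) (divTable (suc k) (table (D (suc k)) N))
    ≡⟨ cong (divTable (suc k)) (divTable-table (suc k) (D (suc k)) N) ⟩
  divTable (suc k) (table (Dhalf k) N)
    ≡⟨ divTable-table (suc k) (Dhalf k) N ⟩
  table (D (2 + k)) N ∎
  where open ≡-Reasoning

Gtable-table : (k N : ℕ) → divTable 0 (Dtable (suc k) N) ≡ table (G (suc k)) N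
Gtable-table k N = begin
  divTable 0 (Dtable (suc k) N)         ≡⟨ cong (divTable 0) (Dtable-table (suc k) N) ⟩
  divTable 0 (table (D (suc k)) N)      ≡⟨ divTable-table 0 (D (suc k)) N ⟩
  table (Div 0 (D (suc k))) N           ≡⟨ table-cong (isDiv-unique 0 (Div-isDiv 0 (D (suc k))) (G-isDiv-D k)) N ⟩
  table (G (suc k)) N                   ∎
  where open ≡-Reasoning

check21 : ℕ → List ℕ → List ℕ → Bool
check21 zero    _        _        = true
check21 (suc c) (y ∷ ys) (x ∷ xs) = (21 * y ≤ᵇ x) ∧ check21 c ys xs
check21 (suc c) _        _        = false

check21-sound : (Y X : ℕ → ℕ) (s lo c : ℕ) → T (check21 c (table Y (c + lo)) (table X (c + lo + s))) →
                ∀ m → lo ≤ m → m < c + lo → 21 * Y m ≤ X (m + s)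
check21-sound Y X s lo zero    ok m lo≤m m<lo = contradiction lo≤m (<⇒≱ m<lo)
check21-sound Y X s lo (suc c) ok m lo≤m (s≤s m≤c+lo) with Equivalence.to T-∧ ok | m≤n⇒m<n∨m≡n m≤c+lo
... | _    , rest | inj₁ m<c+lo = check21-sound Y X s lo c rest m lo≤m m<c+lo
... | head , _    | inj₂ refl   = ≤ᵇ⇒≤ (21 * Y m) (X (m + s)) head

D-dominated-table : (k s lo c : ℕ) → T (check21 c (Dtable (suc k) (c + lo)) (divTable 0 (Dtable (suc k) (c + lo + s)))) →
                    ∀ m → lo ≤ m → m < c + lo → 21 * D (suc k) m ≤ G (suc k) (m + s)
D-dominated-table k s lo c ok = check21-sound (D (suc k)) (G (suc k)) s lo c
  (subst T (cong₂ (check21 c) (Dtable-table (suc k) (c + lo)) (Gtable-table k (c + lo + s))) ok)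

D-dominated : (k s t lo c : ℕ) → 21 ≡ suc s + t → t * suc (2 * k) ≤ c + lo →
              T (check21 c (Dtable (suc k) (c + lo)) (divTable 0 (Dtable (suc k) (c + lo + s)))) →
              ∀ m → lo ≤ m → 21 * D (suc k) m ≤ G (suc k) (m + s)
D-dominated k s t lo c 21≡ t·c≤N ok m lo≤m with m <? c + lo
... | yes m<N = D-dominated-table k s lo c ok m lo≤m m<N
... | no  m≮N = D-dominated-large k s t 21≡ m (≤-trans t·c≤N (≮⇒≥ m≮N))

D-dominated-≥4 : (k : ℕ) → Dominates 21 8 (D (4 + k)) (G (4 + k))
D-dominated-≥4 zero    m = D-dominated 3 8 12 0 84 refl ≤-refl _ m z≤n
D-dominated-≥4 (suc k) =
  isDiv-dominates (4 + k) 21 8 (Div-isDiv (4 + k) (Dhalf (3 + k))) (Ghalf-isDiv-G (3 + k))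
    (isDiv-dominates (4 + k) 21 8 (Div-isDiv (4 + k) (D (4 + k))) (G-isDiv-Ghalf (3 + k)) (D-dominated-≥4 k))

g≥21h-shifted : (j lo : ℕ) → (∀ m → lo ≤ m → 21 * D (2 + j) m ≤ G (2 + j) (m + (2 + j + (2 + j)))) →
                ∀ n → lo ≤ n ∸ (2 + j + (2 + j)) → g (2 + j) n ≥ 21 * h (2 + j) n
g≥21h-shifted j lo dominated n lo≤m = case n <? kk of λ where
    (yes n<kk) → below n<kk
    (no  n≮kk) → above (m∸n+n≡m (≮⇒≥ n≮kk))
  where
  open ≤-Reasoning
  k = 2 + j
  kk = k + k
  m = n ∸ kk
  below : n < kk → 21 * h k n ≤ g k n
  below n<kk = begin
    21 * h k n ≡⟨ cong (21 *_) (trans (h≡shift-D j n) (shift-< kk (D k) n n<kk)) ⟩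
    0          ≤⟨ z≤n ⟩
    g k n      ∎
  above : m + kk ≡ n → 21 * h k n ≤ g k n
  above m+kk≡n = begin
    21 * h k n                   ≡⟨ cong (21 *_) (h≡shift-D j n) ⟩
    21 * shift kk (D k) n        ≡⟨ cong (λ v → 21 * shift kk (D k) v) (trans (sym m+kk≡n) (+-comm m kk)) ⟩
    21 * shift kk (D k) (kk + m) ≡⟨ cong (21 *_) (shift-+ˡ kk (D k) m) ⟩
    21 * D k m                   ≤⟨ dominated m lo≤m ⟩
    G k (m + kk)                 ≡⟨ cong (G k) m+kk≡n ⟩
    G k n                        ≡⟨ g≡G k n ⟨
    g k n                        ∎

g≥21h-one : (n : ℕ) → n ≥ 20 → g 1 n ≥ 21 * h 1 n
g≥21h-one n 20≤n = begin
  21 * h 1 n  ≤⟨ *-monoʳ-≤ 21 (h-one-≤ (2 ≤ᵇ n)) ⟩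
  21          ≤⟨ s≤s 20≤n ⟩
  suc n       ≡⟨ trans (g≡G 1 n) (G-one n) ⟨
  g 1 n       ∎
  where
  open ≤-Reasoning
  h-one-≤ : (b : Bool) → (if b then 1 else 0) ≤ 1
  h-one-≤ true  = ≤-refl
  h-one-≤ false = z≤n

g≥21h-≥4 : (k : ℕ) → k ≥ 4 → (n : ℕ) → g k n ≥ 21 * h k n
g≥21h-≥4 (suc (suc (suc (suc k)))) (s≤s (s≤s (s≤s (s≤s z≤n)))) n = g≥21h-shifted (2 + k) 0 dominated n z≤n
  where
  open ≤-Reasoning
  regroup : ∀ k m → k + k + m + 8 ≡ m + (4 + k + (4 + k))
  regroup = solve-∀
  dominated : ∀ m → 0 ≤ m → 21 * D (4 + k) m ≤ G (4 + k) (m + (4 + k + (4 + k)))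
  dominated m _ = begin
    21 * D (4 + k) m                  ≤⟨ *-monoʳ-≤ 21 (monotone-+ (D-monotone (3 + k)) (k + k) m) ⟩
    21 * D (4 + k) (k + k + m)        ≤⟨ D-dominated-≥4 k (k + k + m) ⟩
    G (4 + k) (k + k + m + 8)         ≡⟨ cong (G (4 + k)) (regroup k m) ⟩
    G (4 + k) (m + (4 + k + (4 + k))) ∎

theorem9p1 : ((n : ℕ) → n ≥ 20 → g 1 n ≥ 21 * h 1 n)
    × ((n : ℕ) → n ≥ 51 → g 2 n ≥ 21 * h 2 n)
    × ((n : ℕ) → n ≥ 67 → g 3 n ≥ 21 * h 3 n)
    × ((k : ℕ) → k ≥ 4 → (n : ℕ) → g k n ≥ 21 * h k n)
theorem9p1 =
    g≥21h-one
  , (λ n 51≤n → g≥21h-shifted 0 47 (D-dominated 1 4 16 47 1 refl ≤-refl _) n (m+n≤o⇒m≤o∸n 47 51≤n))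
  , (λ n 67≤n → g≥21h-shifted 1 61 (D-dominated 2 6 14 61 9 refl ≤-refl _) n (m+n≤o⇒m≤o∸n 61 67≤n))
  , g≥21h-≥4
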